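{- Let $E$ be a finite set and $I\mapsto A_I$ a covariant functor from the poset $\mathcal{P}(E)$ (ordered by inclusion) to abelian groups, with transition maps $r_{I,J}:A_I\to A_J$ for $I\subset J$. Suppose that for every nonempty $I\subset E$ and every $J=I\sqcup\{j\}\subset E$ there is a section $\varphi_{I,J}:A_J\to A_I$ of $r_{I,J}$ (i.e. $r_{I,J}\circ\varphi_{I,J}=\mathrm{id}$) such that for every $k\notin J$, $$\varphi_{I,J}\big(\ker r_{J,J\cup\{k\}}\big)\subset\ker r_{I,I\cup\{k\}}.$$ Then $H^1(\mathcal{C}^\bullet((A_I)_{I\subset E}))=0$.
   Context: $\mathcal{C}^\bullet((A_I)_{I\subset E})$ is the Čech-type cochain complex $0\to\bigoplus_{i\in E}A_{\{i\}}\to\bigoplus_{\{i,j\}\subset E}A_{\{i,j\}}\to\cdots\to\bigoplus_{I\subset E,|I|=k+1}A_I\to\cdots$ (degree $k$ term indexed by subsets of cardinality $k+1$), whose differentials are the alternating sums of the maps $r_{I,J}$ (with respect to a fixed total order on $E$), as for the Čech complex of a covering. -}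

module Defs where

open import Level using (Level; _⊔_; suc)
open import Data.Nat using (ℕ)
open import Data.Fin using (Fin; _<_)
open import Data.Fin.Subset using (Subset; _⊆_; _∪_; ⁅_⁆; Nonempty; _∉_)
open import Data.Fin.Subset.Properties using (p⊆p∪q; q⊆p∪q; x∈p∪q⁻; ⊆-trans)
open import Data.Sum using (inj₁; inj₂)
open import Data.Product using (Σ; ∃; _,_)
open import Algebra.Bundles using (AbelianGroup)
open AbelianGroup using (Carrier)

-- The finite set E is Fin n (with its natural total order); subsets of
-- E are  Subset n  (the poset P(E) ordered by inclusion _⊆_).

-- Since _⊆_ is a (proof-relevant) function type in the library, we
-- require r to be independent of the chosen inclusion proof
-- (P(E) is a poset: at most one arrow I → J).
record PFunctor {c ℓ : Level} (n : ℕ) : Set (suc (c ⊔ ℓ)) where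
  field
    A : Subset n → AbelianGroup c ℓ
  module G (I : Subset n) = AbelianGroup (A I)
  field
    r       : ∀ {I J} → I ⊆ J → Carrier (A I) → Carrier (A J)
    r-irrel : ∀ {I J} (p q : I ⊆ J) (x : Carrier (A I)) →
              G._≈_ J (r p x) (r q x)
    r-cong  : ∀ {I J} (p : I ⊆ J) {x y : Carrier (A I)} →
              G._≈_ I x y → G._≈_ J (r p x) (r p y)
    r-hom   : ∀ {I J} (p : I ⊆ J) (x y : Carrier (A I)) →
              G._≈_ J (r p (G._∙_ I x y)) (G._∙_ J (r p x) (r p y))
    r-id    : ∀ {I} (p : I ⊆ I) (x : Carrier (A I)) → G._≈_ I (r p x) x
    r-comp  : ∀ {I J K} (p : I ⊆ J) (q : J ⊆ K) (x : Carrier (A I)) →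
              G._≈_ K (r q (r p x)) (r (⊆-trans p q) x)

pair : ∀ {n} → Fin n → Fin n → Subset n
pair i j = ⁅ i ⁆ ∪ ⁅ j ⁆

triple : ∀ {n} → Fin n → Fin n → Fin n → Subset n
triple i j k = pair i j ∪ ⁅ k ⁆

∪-lub : ∀ {n} {p q s : Subset n} → p ⊆ s → q ⊆ s → p ∪ q ⊆ s
∪-lub {p = p} p⊆s q⊆s x∈ with x∈p∪q⁻ p _ x∈
... | inj₁ x∈p = p⊆s x∈p
... | inj₂ x∈q = q⊆s x∈q

⊆pairˡ : ∀ {n} (i j : Fin n) → ⁅ i ⁆ ⊆ pair i j
⊆pairˡ i j = p⊆p∪q ⁅ j ⁆

⊆pairʳ : ∀ {n} (i j : Fin n) → ⁅ j ⁆ ⊆ pair i j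
⊆pairʳ i j = q⊆p∪q ⁅ i ⁆ ⁅ j ⁆

⊆tri₂ : ∀ {n} (i j k : Fin n) → pair i j ⊆ triple i j k
⊆tri₂ i j k = p⊆p∪q ⁅ k ⁆

⊆tri₁ : ∀ {n} (i j k : Fin n) → pair i k ⊆ triple i j k
⊆tri₁ i j k = ∪-lub (⊆-trans (⊆pairˡ i j) (⊆tri₂ i j k)) (q⊆p∪q (pair i j) ⁅ k ⁆)

⊆tri₀ : ∀ {n} (i j k : Fin n) → pair j k ⊆ triple i j k
⊆tri₀ i j k = ∪-lub (⊆-trans (⊆pairʳ i j) (⊆tri₂ i j k)) (q⊆p∪q (pair i j) ⁅ k ⁆)

module Cech {c ℓ : Level} {n : ℕ} (F : PFunctor {c} {ℓ} n) where
  open PFunctor F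

  -- C⁰ = ⊕_{i} A_{{i}},  C¹ = ⊕_{i<j} A_{{i,j}}  (finite direct sums = products)
  C⁰ : Set c
  C⁰ = (i : Fin n) → Carrier (A ⁅ i ⁆)

  C¹ : Set c
  C¹ = (i j : Fin n) → i < j → Carrier (A (pair i j))

  d⁰ : C⁰ → C¹
  d⁰ b i j _ = G._-_ (pair i j) (r (⊆pairʳ i j) (b j)) (r (⊆pairˡ i j) (b i))

  d¹ : C¹ → (i j k : Fin n) → i < j → j < k → Carrier (A (triple i j k))
  d¹ c i j k i<j j<k =
    G._∙_ T (G._-_ T (r (⊆tri₀ i j k) (c j k j<k))
                     (r (⊆tri₁ i j k) (c i k (Data.Fin.Properties.<-trans i<j j<k))))
            (r (⊆tri₂ i j k) (c i j i<j))
    where T = triple i j k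
          import Data.Fin.Properties

  IsCocycle : C¹ → Set ℓ
  IsCocycle c = ∀ i j k (i<j : i < j) (j<k : j < k) →
                G._≈_ (triple i j k) (d¹ c i j k i<j j<k) (G.ε (triple i j k))

  IsCoboundary : C¹ → Set (c ⊔ ℓ)
  IsCoboundary c = Σ C⁰ λ b → ∀ i j (i<j : i < j) →
                   G._≈_ (pair i j) (c i j i<j) (d⁰ b i j i<j)

  H¹-vanishes : Set (c ⊔ ℓ)
  H¹-vanishes = ∀ (c : C¹) → IsCocycle c → IsCoboundary c

  SectionHyp : Set (c ⊔ ℓ)
  SectionHyp =
    ∀ (I : Subset n) → Nonempty I → ∀ (j : Fin n) → j ∉ I →
    Σ (Carrier (A (I ∪ ⁅ j ⁆)) → Carrier (A I)) λ φ →
      (∀ {x y} → G._≈_ (I ∪ ⁅ j ⁆) x y → G._≈_ I (φ x) (φ y)) Data.Product.×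
      (∀ x y → G._≈_ I (φ (G._∙_ (I ∪ ⁅ j ⁆) x y)) (G._∙_ I (φ x) (φ y))) Data.Product.×
      (∀ x → G._≈_ (I ∪ ⁅ j ⁆) (r (p⊆p∪q ⁅ j ⁆) (φ x)) x) Data.Product.×
      (∀ (k : Fin n) → k ∉ (I ∪ ⁅ j ⁆) → ∀ x →
        G._≈_ ((I ∪ ⁅ j ⁆) ∪ ⁅ k ⁆) (r (p⊆p∪q ⁅ k ⁆) x) (G.ε ((I ∪ ⁅ j ⁆) ∪ ⁅ k ⁆)) →
        G._≈_ (I ∪ ⁅ k ⁆) (r (p⊆p∪q ⁅ k ⁆) (φ x)) (G.ε (I ∪ ⁅ k ⁆)))
    where import Data.Product

{-# OPTIONS --safe #-}
-- A 1-cocycle d is cleared one index at a time. Suppose d_{ij} = 0 whenever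
-- i < m. The cocycle relation on {l,m,j} with l < m < j shows that d_{mj} dies
-- in A_{l,m,j}; read in A_{j,m}, this puts d_{mj} in the kernel of the
-- restriction to {j,m,l}, so its image β_j under the section φ_{{j},{j,m}}
-- restricts to d_{mj} on {m,j} and to 0 on every {l,j}. Subtracting the
-- coboundary d⁰β keeps d a cocycle and makes it vanish for i ≤ m as well; once
-- every index is cleared the cocycle is 0.

module Submission where

open import Defs
open import Level using (Level)
open import Data.Nat using (ℕ; zero; suc; _+_)
import Data.Nat as ℕ
import Data.Nat.Properties as ℕₚ
open import Data.Fin using (Fin; _<_; toℕ; fromℕ<)
import Data.Fin.Properties as Fₚ
open import Data.Fin.Subset using (Subset; _⊆_; ⁅_⁆; _∉_)
open import Data.Fin.Subset.Properties using (q⊆p∪q; x∈p∪q⁻; ⊆-trans; x∈⁅x⁆; x∈⁅y⁆⇒x≡y)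
open import Data.Sum using (inj₁; inj₂)
open import Data.Product using (_,_; proj₁; proj₂)
open import Relation.Nullary using (¬_; yes; no; contradiction)
open import Relation.Binary.PropositionalEquality as ≡ using (_≡_; _≢_; refl)
open import Algebra.Bundles using (AbelianGroup)

module AbelianGroupProperties {c ℓ : Level} (G : AbelianGroup c ℓ) where
  open AbelianGroup G
  open import Algebra.Properties.AbelianGroup G using (⁻¹-∙-comm)
  open import Algebra.Properties.CommutativeSemigroup commutativeSemigroup using (interchange)
  open import Relation.Binary.Reasoning.Setoid setoid

  -‿∙-interchange : ∀ a b c d → (a - b) ∙ (c - d) ≈ (a ∙ c) - (b ∙ d)
  -‿∙-interchange a b c d = begin
    (a - b) ∙ (c - d)          ≈⟨ interchange a (b ⁻¹) c (d ⁻¹) ⟩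
    (a ∙ c) ∙ (b ⁻¹ ∙ d ⁻¹)    ≈⟨ ∙-congˡ (⁻¹-∙-comm b d) ⟩
    (a ∙ c) - (b ∙ d)          ∎

  -‿-‿interchange : ∀ a b c d → (a - b) - (c - d) ≈ (a - c) - (b - d)
  -‿-‿interchange a b c d = begin
    (a - b) ∙ (c - d) ⁻¹           ≈⟨ ∙-congˡ (sym (⁻¹-∙-comm c (d ⁻¹))) ⟩
    (a - b) ∙ (c ⁻¹ - d ⁻¹)        ≈⟨ -‿∙-interchange a b (c ⁻¹) (d ⁻¹) ⟩
    (a ∙ c ⁻¹) - (b ∙ d ⁻¹)        ∎

  -‿telescope : ∀ x y z → ((z - y) - (z - x)) ∙ (y - x) ≈ ε
  -‿telescope x y z = begin
    ((z - y) - (z - x)) ∙ (y - x)  ≈⟨ ∙-congʳ (-‿-‿interchange z y z x) ⟩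
    ((z - z) - (y - x)) ∙ (y - x)  ≈⟨ ∙-congʳ (∙-congʳ (inverseʳ z)) ⟩
    (ε - (y - x)) ∙ (y - x)        ≈⟨ ∙-congʳ (identityˡ _) ⟩
    (y - x) ⁻¹ ∙ (y - x)           ≈⟨ inverseˡ (y - x) ⟩
    ε                              ∎

module GroupMorphismProperties {c₁ ℓ₁ c₂ ℓ₂ : Level} (G : AbelianGroup c₁ ℓ₁) (H : AbelianGroup c₂ ℓ₂)
  (f : AbelianGroup.Carrier G → AbelianGroup.Carrier H)
  (f-cong : ∀ {x y} → AbelianGroup._≈_ G x y → AbelianGroup._≈_ H (f x) (f y))
  (f-homo : ∀ x y → AbelianGroup._≈_ H (f (AbelianGroup._∙_ G x y)) (AbelianGroup._∙_ H (f x) (f y)))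
  where
  private module G = AbelianGroup G
  open AbelianGroup H
  open import Algebra.Properties.AbelianGroup H using (identityˡ-unique; inverseʳ-unique)

  ε-homo : f G.ε ≈ ε
  ε-homo = identityˡ-unique (f G.ε) (f G.ε) (trans (sym (f-homo G.ε G.ε)) (f-cong (G.identityʳ G.ε)))

  ⁻¹-homo : ∀ x → f (x G.⁻¹) ≈ f x ⁻¹
  ⁻¹-homo x = inverseʳ-unique (f x) (f (x G.⁻¹))
    (trans (sym (f-homo x (x G.⁻¹))) (trans (f-cong (G.inverseʳ x)) ε-homo))

  -‿homo : ∀ x y → f (x G.- y) ≈ f x - f y
  -‿homo x y = trans (f-homo x (y G.⁻¹)) (∙-congˡ (⁻¹-homo y))

module _ {n : ℕ} where
  ⊆triple₁ : (i j k : Fin n) → ⁅ i ⁆ ⊆ triple i j k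
  ⊆triple₁ i j k = ⊆-trans (⊆pairˡ i j) (⊆tri₂ i j k)

  ⊆triple₂ : (i j k : Fin n) → ⁅ j ⁆ ⊆ triple i j k
  ⊆triple₂ i j k = ⊆-trans (⊆pairʳ i j) (⊆tri₂ i j k)

  ⊆triple₃ : (i j k : Fin n) → ⁅ k ⁆ ⊆ triple i j k
  ⊆triple₃ i j k = q⊆p∪q (pair i j) ⁅ k ⁆

  pair-swap : (i j : Fin n) → pair i j ⊆ pair j i
  pair-swap i j = ∪-lub (⊆pairʳ j i) (⊆pairˡ j i)

  triple-reverse : (i j k : Fin n) → triple i j k ⊆ triple k j i
  triple-reverse i j k = ∪-lub (∪-lub (⊆triple₃ k j i) (⊆triple₂ k j i)) (⊆triple₁ k j i)

  ∉⁅⁆ : {i j : Fin n} → i ≢ j → i ∉ ⁅ j ⁆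
  ∉⁅⁆ {j = j} i≢j i∈ = i≢j (x∈⁅y⁆⇒x≡y j i∈)

  ∉pair : {i j k : Fin n} → i ≢ j → i ≢ k → i ∉ pair j k
  ∉pair {j = j} {k} i≢j i≢k i∈ with x∈p∪q⁻ ⁅ j ⁆ ⁅ k ⁆ i∈
  ... | inj₁ i∈⁅j⁆ = ∉⁅⁆ i≢j i∈⁅j⁆
  ... | inj₂ i∈⁅k⁆ = ∉⁅⁆ i≢k i∈⁅k⁆

module FunctorProperties {c ℓ : Level} {n : ℕ} (F : PFunctor {c} {ℓ} n) where
  open PFunctor F

  module _ {I J : Subset n} (p : I ⊆ J) where
    open GroupMorphismProperties (A I) (A J) (r p) (r-cong p) (r-hom p) public
      using () renaming (ε-homo to r-ε; -‿homo to r--)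

  r-∘ : ∀ {I J K} (p : I ⊆ J) (q : J ⊆ K) (s : I ⊆ K) x → G._≈_ K (r q (r p x)) (r s x)
  r-∘ p q s x = G.trans _ (r-comp p q x) (r-irrel _ s x)

  r-ker-mono : ∀ {I J K} (p : I ⊆ J) (q : J ⊆ K) (s : I ⊆ K) {x} →
               G._≈_ J (r p x) (G.ε J) → G._≈_ K (r s x) (G.ε K)
  r-ker-mono {K = K} p q s {x} rx≈ε = begin
    r s x        ≈⟨ sym (r-∘ p q s x) ⟩
    r q (r p x)  ≈⟨ r-cong q rx≈ε ⟩
    r q (G.ε _)  ≈⟨ r-ε q ⟩
    ε            ∎
    where open G K
          open import Relation.Binary.Reasoning.Setoid setoid

module CechProperties {c ℓ : Level} {n : ℕ} (F : PFunctor {c} {ℓ} n) where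
  open PFunctor F
  open Cech F
  open FunctorProperties F
  module P (I : Subset n) = AbelianGroupProperties (A I)

  _⊕_ : C⁰ → C⁰ → C⁰
  (b ⊕ b′) i = G._∙_ ⁅ i ⁆ (b i) (b′ i)

  _⊖_ : C¹ → C¹ → C¹
  (c ⊖ c′) i j h = G._-_ (pair i j) (c i j h) (c′ i j h)

  r-d⁰ : ∀ (b : C⁰) {i j} (h : i < j) {T} (p : pair i j ⊆ T) (pᵢ : ⁅ i ⁆ ⊆ T) (pⱼ : ⁅ j ⁆ ⊆ T) →
         G._≈_ T (r p (d⁰ b i j h)) (G._-_ T (r pⱼ (b j)) (r pᵢ (b i)))
  r-d⁰ b {i} {j} h {T} p pᵢ pⱼ =
    trans (r-- p _ _) (∙-cong (r-∘ _ p pⱼ (b j)) (⁻¹-cong (r-∘ _ p pᵢ (b i))))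
    where open G T

  d⁰-ε : ∀ i j (h : i < j) → G._≈_ (pair i j) (d⁰ (λ k → G.ε ⁅ k ⁆) i j h) (G.ε (pair i j))
  d⁰-ε i j h = trans (∙-cong (r-ε _) (⁻¹-cong (r-ε _))) (inverseʳ ε)
    where open G (pair i j)

  d⁰-homo : ∀ b b′ i j (h : i < j) →
            G._≈_ (pair i j) (d⁰ (b ⊕ b′) i j h) (G._∙_ (pair i j) (d⁰ b i j h) (d⁰ b′ i j h))
  d⁰-homo b b′ i j h =
    trans (∙-cong (r-hom _ _ _) (⁻¹-cong (r-hom _ _ _))) (sym (P.-‿∙-interchange (pair i j) _ _ _ _))
    where open G (pair i j)

  d¹-homo‿- : ∀ c c′ i j k (i<j : i < j) (j<k : j < k) →
              G._≈_ (triple i j k) (d¹ (c ⊖ c′) i j k i<j j<k)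
                                   (G._-_ (triple i j k) (d¹ c i j k i<j j<k) (d¹ c′ i j k i<j j<k))
  d¹-homo‿- c c′ i j k i<j j<k =
    trans (∙-cong (∙-cong (r-- _ _ _) (⁻¹-cong (r-- _ _ _))) (r-- _ _ _))
      (trans (∙-congʳ (P.-‿-‿interchange T _ _ _ _)) (P.-‿∙-interchange T _ _ _ _))
    where T : Subset n
          T = triple i j k
          open G T

  d⁰-isCocycle : ∀ b → IsCocycle (d⁰ b)
  d⁰-isCocycle b i j k i<j j<k =
    trans (∙-cong (∙-cong (r-d⁰ b j<k (⊆tri₀ i j k) pⱼ pₖ) (⁻¹-cong (r-d⁰ b (Fₚ.<-trans i<j j<k) (⊆tri₁ i j k) pᵢ pₖ)))
                  (r-d⁰ b i<j (⊆tri₂ i j k) pᵢ pⱼ))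
          (P.-‿telescope T _ _ _)
    where T : Subset n
          T = triple i j k
          open G T
          pᵢ : ⁅ i ⁆ ⊆ T
          pᵢ = ⊆triple₁ i j k
          pⱼ : ⁅ j ⁆ ⊆ T
          pⱼ = ⊆triple₂ i j k
          pₖ : ⁅ k ⁆ ⊆ T
          pₖ = ⊆triple₃ i j k

  ⊖-isCocycle : ∀ {c c′} → IsCocycle c → IsCocycle c′ → IsCocycle (c ⊖ c′)
  ⊖-isCocycle {c} {c′} c-cocycle c′-cocycle i j k i<j j<k =
    trans (d¹-homo‿- c c′ i j k i<j j<k)
          (trans (∙-cong (c-cocycle i j k i<j j<k) (⁻¹-cong (c′-cocycle i j k i<j j<k))) (inverseʳ ε))
    where open G (triple i j k)

  isCoboundary-⊖-d⁰ : ∀ c β → IsCoboundary (c ⊖ d⁰ β) → IsCoboundary c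
  isCoboundary-⊖-d⁰ c β (b , c⊖d⁰β≈d⁰b) = b ⊕ β , c≈d⁰[b⊕β]
    where
    c≈d⁰[b⊕β] : ∀ i j (h : i < j) → G._≈_ (pair i j) (c i j h) (d⁰ (b ⊕ β) i j h)
    c≈d⁰[b⊕β] i j h = begin
      c i j h                             ≈⟨ sym (//-rightDividesˡ (d⁰ β i j h) (c i j h)) ⟩
      (c i j h - d⁰ β i j h) ∙ d⁰ β i j h ≈⟨ ∙-congʳ (c⊖d⁰β≈d⁰b i j h) ⟩
      d⁰ b i j h ∙ d⁰ β i j h             ≈⟨ sym (d⁰-homo b β i j h) ⟩
      d⁰ (b ⊕ β) i j h                    ∎
      where open G (pair i j)
            open import Algebra.Properties.AbelianGroup (A (pair i j)) using (//-rightDividesˡ)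
            open import Relation.Binary.Reasoning.Setoid setoid

module Normalisation {c ℓ : Level} {n : ℕ} (F : PFunctor {c} {ℓ} n) (sections : Cech.SectionHyp F) where
  open PFunctor F
  open Cech F
  open FunctorProperties F
  open CechProperties F

  VanishesBelow : ℕ → C¹ → Set ℓ
  VanishesBelow m c = ∀ i j (h : i < j) → toℕ i ℕ.< m → G._≈_ (pair i j) (c i j h) (G.ε (pair i j))

  cocycle-vanishesBelow⇒ker : ∀ {m c} → IsCocycle c → VanishesBelow m c →
    ∀ {l i j} (l<i : l < i) (i<j : i < j) → toℕ l ℕ.< m →
    G._≈_ (triple l i j) (r (⊆tri₀ l i j) (c i j i<j)) (G.ε (triple l i j))
  cocycle-vanishesBelow⇒ker {c = c} c-cocycle c-vanishes {l} {i} {j} l<i i<j l<m = begin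
    x              ≈⟨ sym (//-rightDividesˡ y x) ⟩
    (x - y) ∙ y    ≈⟨ ∙-congˡ (trans y≈ε (sym z≈ε)) ⟩
    (x - y) ∙ z    ≈⟨ c-cocycle l i j l<i i<j ⟩
    ε              ∎
    where
    T : Subset n
    T = triple l i j
    open G T
    open import Algebra.Properties.AbelianGroup (A T) using (//-rightDividesˡ)
    open import Relation.Binary.Reasoning.Setoid setoid
    l<j : l < j
    l<j = Fₚ.<-trans l<i i<j
    x y z : Carrier
    x = r (⊆tri₀ l i j) (c i j i<j)
    y = r (⊆tri₁ l i j) (c l j l<j)
    z = r (⊆tri₂ l i j) (c l i l<i)
    y≈ε : y ≈ ε
    y≈ε = trans (r-cong _ (c-vanishes l j l<j l<m)) (r-ε _)
    z≈ε : z ≈ ε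
    z≈ε = trans (r-cong _ (c-vanishes l i l<i l<m)) (r-ε _)

  module Step (M : Fin n) (d : C¹) (d-cocycle : IsCocycle d) (d-vanishes : VanishesBelow (toℕ M) d) where

    module _ {j : Fin n} (M<j : M < j) where
      private
        M∉⁅j⁆ : M ∉ ⁅ j ⁆
        M∉⁅j⁆ = ∉⁅⁆ (Fₚ.<⇒≢ M<j)

      φ : G.Carrier (pair j M) → G.Carrier ⁅ j ⁆
      φ = proj₁ (sections ⁅ j ⁆ (j , x∈⁅x⁆ j) M M∉⁅j⁆)

      φ-section : ∀ x → G._≈_ (pair j M) (r (⊆pairˡ j M) (φ x)) x
      φ-section = proj₁ (proj₂ (proj₂ (proj₂ (sections ⁅ j ⁆ (j , x∈⁅x⁆ j) M M∉⁅j⁆))))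

      φ-ker : ∀ k → k ∉ pair j M → ∀ x →
              G._≈_ (triple j M k) (r (⊆tri₂ j M k) x) (G.ε (triple j M k)) →
              G._≈_ (pair j k) (r (⊆pairˡ j k) (φ x)) (G.ε (pair j k))
      φ-ker = proj₂ (proj₂ (proj₂ (proj₂ (sections ⁅ j ⁆ (j , x∈⁅x⁆ j) M M∉⁅j⁆))))

    β : C⁰
    β j with M Fₚ.<? j
    ... | yes M<j = φ M<j (r (pair-swap M j) (d M j M<j))
    ... | no _    = G.ε ⁅ j ⁆

    β-section : ∀ {j} (M<j : M < j) → G._≈_ (pair M j) (r (⊆pairʳ M j) (β j)) (d M j M<j)
    β-section {j} M<j with M Fₚ.<? j
    ... | no M≮j = contradiction M<j M≮j
    ... | yes M<j′ = begin
      r (⊆pairʳ M j) (φ M<j′ x)                       ≈⟨ sym (r-∘ (⊆pairˡ j M) (pair-swap j M) _ _) ⟩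
      r (pair-swap j M) (r (⊆pairˡ j M) (φ M<j′ x))   ≈⟨ r-cong (pair-swap j M) (φ-section M<j′ x) ⟩
      r (pair-swap j M) x                             ≈⟨ r-∘ (pair-swap M j) (pair-swap j M) (λ z → z) _ ⟩
      r (λ z → z) (d M j M<j′)                        ≈⟨ r-id _ _ ⟩
      d M j M<j′                                      ≡⟨ ≡.cong (d M j) (Fₚ.<-irrelevant M<j′ M<j) ⟩
      d M j M<j                                       ∎
      where open G (pair M j)
            open import Relation.Binary.Reasoning.Setoid setoid
            x : G.Carrier (pair j M)
            x = r (pair-swap M j) (d M j M<j′)

    β-not-above : ∀ {i} → ¬ M < i → G._≈_ ⁅ i ⁆ (β i) (G.ε ⁅ i ⁆)
    β-not-above {i} M≮i with M Fₚ.<? i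
    ... | yes M<i = contradiction M<i M≮i
    ... | no _    = G.refl ⁅ i ⁆

    β-ker : ∀ {i j} → i < M → G._≈_ (pair i j) (r (⊆pairʳ i j) (β j)) (G.ε (pair i j))
    β-ker {i} {j} i<M with M Fₚ.<? j
    ... | no _    = r-ε _
    ... | yes M<j = r-ker-mono (⊆pairˡ j i) (pair-swap j i) (⊆pairʳ i j) (φ-ker M<j i i∉pair x x-ker)
      where
      x : G.Carrier (pair j M)
      x = r (pair-swap M j) (d M j M<j)
      i∉pair : i ∉ pair j M
      i∉pair = ∉pair (Fₚ.<⇒≢ (Fₚ.<-trans i<M M<j)) (Fₚ.<⇒≢ i<M)
      x-ker : G._≈_ (triple j M i) (r (⊆tri₂ j M i) x) (G.ε (triple j M i))
      x-ker = G.trans _ (r-∘ (pair-swap M j) (⊆tri₂ j M i) (⊆-trans (⊆tri₀ i M j) (triple-reverse i M j)) _)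
                (r-ker-mono (⊆tri₀ i M j) (triple-reverse i M j) _
                  (cocycle-vanishesBelow⇒ker d-cocycle d-vanishes i<M M<j i<M))

    d⁰β≈d : ∀ i j (h : i < j) → toℕ i ℕ.< suc (toℕ M) → G._≈_ (pair i j) (d⁰ β i j h) (d i j h)
    d⁰β≈d i j h i≤M with ℕₚ.m<1+n⇒m<n∨m≡n i≤M
    ... | inj₁ i<M = begin
      r (⊆pairʳ i j) (β j) - r (⊆pairˡ i j) (β i)   ≈⟨ ∙-cong (β-ker i<M) (⁻¹-cong βᵢ≈ε) ⟩
      ε - ε                                         ≈⟨ inverseʳ ε ⟩
      ε                                             ≈⟨ sym (d-vanishes i j h i<M) ⟩
      d i j h                                       ∎
      where open G (pair i j)
            open import Relation.Binary.Reasoning.Setoid setoid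
            βᵢ≈ε : r (⊆pairˡ i j) (β i) ≈ ε
            βᵢ≈ε = trans (r-cong _ (β-not-above (Fₚ.<-asym i<M))) (r-ε _)
    ... | inj₂ i≡M with Fₚ.toℕ-injective i≡M
    ...   | refl = begin
      r (⊆pairʳ M j) (β j) - r (⊆pairˡ M j) (β M)   ≈⟨ ∙-cong (β-section h) (⁻¹-cong βₘ≈ε) ⟩
      d M j h - ε                                   ≈⟨ ∙-congˡ ε⁻¹≈ε ⟩
      d M j h ∙ ε                                   ≈⟨ identityʳ _ ⟩
      d M j h                                       ∎
      where open G (pair M j)
            open import Algebra.Properties.AbelianGroup (A (pair M j)) using (ε⁻¹≈ε)
            open import Relation.Binary.Reasoning.Setoid setoid
            βₘ≈ε : r (⊆pairˡ M j) (β M) ≈ ε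
            βₘ≈ε = trans (r-cong _ (β-not-above (Fₚ.<-irrefl ≡.refl))) (r-ε _)

    d⊖d⁰β-vanishesBelow : VanishesBelow (suc (toℕ M)) (d ⊖ d⁰ β)
    d⊖d⁰β-vanishesBelow i j h i≤M = x≈y⇒x∙y⁻¹≈ε (sym (d⁰β≈d i j h i≤M))
      where open G (pair i j)
            open import Algebra.Properties.AbelianGroup (A (pair i j)) using (x≈y⇒x∙y⁻¹≈ε)

  vanishesBelow⇒isCoboundary : ∀ k m → k + m ≡ n → ∀ d → IsCocycle d → VanishesBelow m d → IsCoboundary d
  vanishesBelow⇒isCoboundary zero m ≡.refl d d-cocycle d-vanishes =
    (λ i → G.ε ⁅ i ⁆) , λ i j h → G.trans _ (d-vanishes i j h (Fₚ.toℕ<n i)) (G.sym _ (d⁰-ε i j h))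
  vanishesBelow⇒isCoboundary (suc k) m k+1+m≡n d d-cocycle d-vanishes =
    isCoboundary-⊖-d⁰ d β
      (vanishesBelow⇒isCoboundary k (suc m) (≡.trans (ℕₚ.+-suc k m) k+1+m≡n) (d ⊖ d⁰ β)
        (⊖-isCocycle d-cocycle (d⁰-isCocycle β))
        (≡.subst (λ m → VanishesBelow (suc m) (d ⊖ d⁰ β)) toℕM≡m d⊖d⁰β-vanishesBelow))
    where
    m<n : m ℕ.< n
    m<n = ≡.subst (m ℕ.<_) k+1+m≡n (ℕ.s≤s (ℕₚ.m≤n+m m k))
    M : Fin n
    M = fromℕ< m<n
    toℕM≡m : toℕ M ≡ m
    toℕM≡m = Fₚ.toℕ-fromℕ< m<n
    open Step M d d-cocycle (≡.subst (λ m → VanishesBelow m d) (≡.sym toℕM≡m) d-vanishes)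

mainTheorem15 : ∀ {c ℓ : Level} (n : ℕ) (F : PFunctor {c} {ℓ} n) →
    Cech.SectionHyp F → Cech.H¹-vanishes F
mainTheorem15 n F sections c c-cocycle =
  Normalisation.vanishesBelow⇒isCoboundary F sections n 0 (ℕₚ.+-identityʳ n) c c-cocycle (λ i j h ())
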